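{- Let $k\ge4$, $V=[k]\times[k]$, and let $f:2^V\to\mathbb{R}_{\ge0}$ be given by $f(S)=\sum_{i=1}^k\big(g(R_i\cap S)+g(C_i\cap S)\big)$, where $R_i=\{(i,j):j\in[k]\}$, $C_i=\{(j,i):j\in[k]\}$, $g(S)=\phi_t(|S|)$ if $S$ contains some $(\ell,\ell)$ and $g(S)=\phi_n(|S|)$ otherwise, with $\phi_n(a)=\min\{a,\frac78k\}$ and $\phi_t(a)=\min\{\frac38ka,\frac38k+a-1,\frac78k\}$. Then $\mathrm{OPT}(f)\le\frac{9k^2-4k}{4}$.
   Context: $\mathrm{OPT}(f)=\min\{\sum_{i=1}^k f(V_i): V_1,\dots,V_k$ is a partition of $V$ with $(i,i)\in V_i$ for all $i\in[k]\}$. -}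

module Defs where

open import Data.Nat as ℕ using (ℕ; zero; suc)
open import Data.Bool using (Bool; true; false; if_then_else_; _∧_; _∨_)
open import Data.Fin using (Fin; zero; suc; _≟_)
open import Data.Product using (_×_; _,_)
open import Data.Integer as ℤ using (ℤ; +_)
open import Data.Rational using (ℚ; _/_; _+_; _-_; _*_; _⊓_; 1ℚ; 0ℚ)
open import Relation.Nullary.Decidable using (⌊_⌋)

V : ℕ → Set
V k = Fin k × Fin k

Subset : ℕ → Set
Subset k = V k → Bool

sumℕ : ∀ {n} → (Fin n → ℕ) → ℕ
sumℕ {zero}  f = 0
sumℕ {suc n} f = ℕ._+_ (f zero) (sumℕ (λ i → f (suc i)))

sumℚ : ∀ {n} → (Fin n → ℚ) → ℚ
sumℚ {zero}  f = 0ℚ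
sumℚ {suc n} f = f zero + sumℚ (λ i → f (suc i))

anyFin : ∀ {n} → (Fin n → Bool) → Bool
anyFin {zero}  f = false
anyFin {suc n} f = f zero ∨ anyFin (λ i → f (suc i))

card : ∀ {k} → Subset k → ℕ
card S = sumℕ (λ i → sumℕ (λ j → if S (i , j) then 1 else 0))

_∩_ : ∀ {k} → Subset k → Subset k → Subset k
(S ∩ T) v = S v ∧ T v

Row : ∀ {k} → Fin k → Subset k
Row i (a , b) = ⌊ a ≟ i ⌋

Col : ∀ {k} → Fin k → Subset k
Col i (a , b) = ⌊ b ≟ i ⌋

hasDiag : ∀ {k} → Subset k → Bool
hasDiag S = anyFin (λ ℓ → S (ℓ , ℓ))

φn : ℕ → ℕ → ℚ
φn k a = (+ a / 1) ⊓ (+ (ℕ._*_ 7 k) / 8)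

φt : ℕ → ℕ → ℚ
φt k a = ((+ (ℕ._*_ (ℕ._*_ 3 k) a) / 8) ⊓ ((+ (ℕ._*_ 3 k) / 8) + (+ a / 1) - 1ℚ))
         ⊓ (+ (ℕ._*_ 7 k) / 8)

g : ∀ k → Subset k → ℚ
g k S = if hasDiag S then φt k (card S) else φn k (card S)

f : ∀ k → Subset k → ℚ
f k S = sumℚ (λ i → g k (Row i ∩ S) + g k (Col i ∩ S))

-- A partition V_1,…,V_k of V with (i,i) ∈ V_i is encoded by the labelling
-- σ : V → [k] (V_i = σ⁻¹(i)) with σ(i,i) = i.
Part : ∀ {k} → (V k → Fin k) → Fin k → Subset k
Part σ i v = ⌊ σ v ≟ i ⌋

cost : ∀ k → (V k → Fin k) → ℚ
cost k σ = sumℚ (λ i → f k (Part σ i))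

-- Proof idea: take the partition of V into its rows, V_i = R_i.  Inside V_i the row R_i
-- is one set containing (i,i), costing at most 7k/8, and every other row is empty.  Each
-- column meets V_i in the single cell (i,j), which costs φt(1) = 3k/8 when j = i and
-- φn(1) = 1 otherwise.  Hence f(V_i) ≤ 7k/8 + 3k/8 + (k - 1) = (9k - 4)/4, and summing
-- over the k blocks gives (9k² - 4k)/4.  Working in eighths keeps all sums in ℕ.
module Submission where

open import Defs
open import Data.Nat using (ℕ; _≤_; _*_)
open import Data.Fin using (Fin)
open import Data.Product using (Σ; _×_; _,_)
open import Relation.Binary.PropositionalEquality using (_≡_)
open import Data.Integer using (+_; _-_)
open import Data.Rational using (_/_) renaming (_≤_ to _≤ℚ_)

open import Data.Bool using (Bool; true; false; if_then_else_; _∧_; _∨_)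
open import Data.Bool.Properties using (∧-comm; ∨-zeroʳ)
open import Data.Fin using (zero; suc; _≟_)
open import Data.Fin.Properties using (suc-injective)
import Data.Integer as ℤ
import Data.Integer.Properties as ℤ
import Data.Integer.Tactic.RingSolver as ℤ-Solver
open import Data.Nat as ℕ using (zero; suc; _+_)
import Data.Nat.Properties as ℕ
import Algebra.Properties.CommutativeSemigroup ℕ.+-commutativeSemigroup as +-CS
import Data.Nat.Tactic.RingSolver as ℕ-Solver
open import Data.Product using (proj₁)
open import Data.Rational as ℚ using (ℚ; 0ℚ; 1ℚ; toℚᵘ)
import Data.Rational.Properties as ℚ
open import Data.Rational.Unnormalised as ℚᵘ using (mkℚᵘ; *≡*)
import Data.Rational.Unnormalised.Properties as ℚᵘ
open import Function using (_∘_)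
open import Relation.Nullary.Decidable using (yes; no; ⌊_⌋; isYes≗does; dec-true; dec-false)
open import Relation.Binary.PropositionalEquality
  using (refl; trans; cong; cong₂; _≢_; module ≡-Reasoning)

private
  variable
    k n : ℕ

sumℕ-const : ∀ {h : Fin n → ℕ} c → (∀ i → h i ≡ c) → sumℕ h ≡ n * c
sumℕ-const {zero}  c p = refl
sumℕ-const {suc n} c p = cong₂ _+_ (p zero) (sumℕ-const c (p ∘ suc))

sumℕ-zero : {h : Fin n → ℕ} → (∀ i → h i ≡ 0) → sumℕ h ≡ 0
sumℕ-zero {n} p = trans (sumℕ-const 0 p) (ℕ.*-zeroʳ n)

sumℕ-supported : ∀ {h : Fin n → ℕ} i → (∀ j → j ≢ i → h j ≡ 0) → sumℕ h ≡ h i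
sumℕ-supported {h = h} zero p =
  trans (cong (λ s → h zero + s) (sumℕ-zero (λ j → p (suc j) λ ()))) (ℕ.+-identityʳ (h zero))
sumℕ-supported {h = h} (suc i) p = trans
  (cong (_+ sumℕ (h ∘ suc)) (p zero λ ()))
  (sumℕ-supported i (λ j j≢i → p (suc j) (j≢i ∘ suc-injective)))

sumℕ-except : ∀ {h : Fin n → ℕ} i {x y} → h i ≡ x → (∀ j → j ≢ i → h j ≡ y) →
              sumℕ h + y ≡ x + n * y
sumℕ-except {suc n} {h} zero {x} {y} hᵢ p = begin
  h zero + sumℕ (h ∘ suc) + y ≡⟨ cong₂ (λ a b → a + b + y) hᵢ (sumℕ-const y (λ j → p (suc j) λ ())) ⟩
  x + n * y + y               ≡⟨ ℕ.+-assoc x (n * y) y ⟩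
  x + (n * y + y)             ≡⟨ cong (λ s → x + s) (ℕ.+-comm (n * y) y) ⟩
  x + suc n * y               ∎
  where open ≡-Reasoning
sumℕ-except {suc n} {h} (suc i) {x} {y} hᵢ p = begin
  h zero + sumℕ (h ∘ suc) + y   ≡⟨ cong (λ a → a + sumℕ (h ∘ suc) + y) (p zero λ ()) ⟩
  y + sumℕ (h ∘ suc) + y        ≡⟨ ℕ.+-assoc y (sumℕ (h ∘ suc)) y ⟩
  y + (sumℕ (h ∘ suc) + y)      ≡⟨ cong (λ s → y + s) (sumℕ-except i hᵢ (λ j j≢i → p (suc j) (j≢i ∘ suc-injective))) ⟩
  y + (x + n * y)               ≡⟨ +-CS.x∙yz≈y∙xz y x (n * y) ⟩
  x + suc n * y                 ∎
  where open ≡-Reasoning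

sumℚ-mono-≤ : {h h′ : Fin n → ℚ} → (∀ i → h i ≤ℚ h′ i) → sumℚ h ≤ℚ sumℚ h′
sumℚ-mono-≤ {zero}  p = ℚ.≤-refl
sumℚ-mono-≤ {suc n} p = ℚ.+-mono-≤ (p zero) (sumℚ-mono-≤ (p ∘ suc))

anyFin-true : ∀ {h : Fin n → Bool} i → h i ≡ true → anyFin h ≡ true
anyFin-true {h = h} zero  hᵢ = cong (_∨ anyFin (h ∘ suc)) hᵢ
anyFin-true {h = h} (suc i) hᵢ =
  trans (cong (h zero ∨_) (anyFin-true i hᵢ)) (∨-zeroʳ (h zero))

anyFin-false : {h : Fin n → Bool} → (∀ i → h i ≡ false) → anyFin h ≡ false
anyFin-false {zero}  p = refl
anyFin-false {suc n} p = cong₂ _∨_ (p zero) (anyFin-false (p ∘ suc))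

eighths : ℕ → ℚ
eighths n = + n / 8

mkℚᵘ-+-sameDenominator : ∀ x y → mkℚᵘ x 7 ℚᵘ.+ mkℚᵘ y 7 ℚᵘ.≃ mkℚᵘ (x ℤ.+ y) 7
mkℚᵘ-+-sameDenominator x y = *≡* (identity x y)
  where
  identity : ∀ x y → (x ℤ.* + 8 ℤ.+ y ℤ.* + 8) ℤ.* + 8 ≡ (x ℤ.+ y) ℤ.* + 64
  identity = ℤ-Solver.solve-∀

eighths-+ : ∀ m n → eighths m ℚ.+ eighths n ≡ eighths (m + n)
eighths-+ m n = ℚ.toℚᵘ-injective (begin
  toℚᵘ (eighths m ℚ.+ eighths n)              ≈⟨ ℚ.toℚᵘ-homo-+ (eighths m) (eighths n) ⟩
  toℚᵘ (eighths m) ℚᵘ.+ toℚᵘ (eighths n)      ≈⟨ ℚᵘ.+-cong (ℚ.toℚᵘ-fromℚᵘ (mkℚᵘ (+ m) 7)) (ℚ.toℚᵘ-fromℚᵘ (mkℚᵘ (+ n) 7)) ⟩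
  mkℚᵘ (+ m) 7 ℚᵘ.+ mkℚᵘ (+ n) 7              ≈⟨ mkℚᵘ-+-sameDenominator (+ m) (+ n) ⟩
  mkℚᵘ (+ m ℤ.+ + n) 7                         ≡⟨ cong (λ x → mkℚᵘ x 7) (ℤ.pos-+ m n) ⟨
  mkℚᵘ (+ (m + n)) 7                           ≈⟨ ℚ.toℚᵘ-fromℚᵘ (mkℚᵘ (+ (m + n)) 7) ⟨
  toℚᵘ (eighths (m + n))                       ∎)
  where open ℚᵘ.≃-Reasoning

eighths-double : ∀ n → eighths (2 * n) ≡ + n / 4
eighths-double n = ℚ.fromℚᵘ-cong {mkℚᵘ (+ (2 * n)) 7} {mkℚᵘ (+ n) 3} (*≡* (begin
  + (2 * n) ℤ.* + 4  ≡⟨ ℤ.pos-* (2 * n) 4 ⟨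
  + (2 * n * 4)      ≡⟨ cong +_ (rearrange n) ⟩
  + (n * 8)          ≡⟨ ℤ.pos-* n 8 ⟩
  + n ℤ.* + 8        ∎))
  where
  open ≡-Reasoning
  rearrange : ∀ n → 2 * n * 4 ≡ n * 8
  rearrange = ℕ-Solver.solve-∀

sumℚ-eighths : (h : Fin n → ℕ) → sumℚ (eighths ∘ h) ≡ eighths (sumℕ h)
sumℚ-eighths {zero}  h = refl
sumℚ-eighths {suc n} h = trans
  (cong (eighths (h zero) ℚ.+_) (sumℚ-eighths (h ∘ suc)))
  (eighths-+ (h zero) (sumℕ (h ∘ suc)))

+[m+n]-+n≡+m : ∀ m n → + (m + n) - + n ≡ + m
+[m+n]-+n≡+m m n = begin
  + (m + n) - + n   ≡⟨ ℤ.m-n≡m⊖n (m + n) n ⟩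
  (m + n) ℤ.⊖ n     ≡⟨ ℤ.⊖-≥ (ℕ.m≤n+m n m) ⟩
  + (m + n ℕ.∸ n)   ≡⟨ cong +_ (ℕ.m+n∸n≡m m n) ⟩
  + m               ∎
  where open ≡-Reasoning

⌊≟⌋-refl : (i : Fin k) → ⌊ i ≟ i ⌋ ≡ true
⌊≟⌋-refl i = trans (isYes≗does (i ≟ i)) (dec-true (i ≟ i) refl)

⌊≟⌋-≢ : {i j : Fin k} → i ≢ j → ⌊ i ≟ j ⌋ ≡ false
⌊≟⌋-≢ {i = i} {j} i≢j = trans (isYes≗does (i ≟ j)) (dec-false (i ≟ j) i≢j)

indicator : Bool → ℕ
indicator b = if b then 1 else 0

card-empty : {S : Subset k} → (∀ v → S v ≡ false) → card S ≡ 0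
card-empty p = sumℕ-zero (λ a → sumℕ-zero (λ b → cong indicator (p (a , b))))

card-cell : {S : Subset k} (i j : Fin k) →
            (∀ a b → S (a , b) ≡ ⌊ a ≟ i ⌋ ∧ ⌊ b ≟ j ⌋) → card S ≡ 1
card-cell {S = S} i j p = begin
  card S                                ≡⟨ sumℕ-supported i (λ a a≢i → sumℕ-zero (λ b → outside-row a≢i b)) ⟩
  sumℕ (λ b → indicator (S (i , b)))    ≡⟨ sumℕ-supported j outside-column ⟩
  indicator (S (i , j))                 ≡⟨ cong indicator (trans (p i j) (cong₂ _∧_ i≟i (⌊≟⌋-refl j))) ⟩
  1                                     ∎
  where
  open ≡-Reasoning
  i≟i : ⌊ i ≟ i ⌋ ≡ true
  i≟i = ⌊≟⌋-refl i
  outside-row : ∀ {a} → a ≢ i → ∀ b → indicator (S (a , b)) ≡ 0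
  outside-row {a} a≢i b = cong indicator (trans (p a b) (cong (_∧ ⌊ b ≟ j ⌋) (⌊≟⌋-≢ a≢i)))
  outside-column : ∀ b → b ≢ j → indicator (S (i , b)) ≡ 0
  outside-column b b≢j = cong indicator (trans (p i b) (cong₂ _∧_ i≟i (⌊≟⌋-≢ b≢j)))

g-diagonal : (S : Subset k) → hasDiag S ≡ true → g k S ≡ φt k (card S)
g-diagonal {k} S d = cong (λ b → if b then φt k (card S) else φn k (card S)) d

g-offDiagonal : (S : Subset k) → hasDiag S ≡ false → g k S ≡ φn k (card S)
g-offDiagonal {k} S d = cong (λ b → if b then φt k (card S) else φn k (card S)) d

φt≤7k/8 : ∀ k a → φt k a ≤ℚ eighths (7 * k)
φt≤7k/8 k a = ℚ.p⊓q≤q (eighths (3 * k * a) ℚ.⊓ (eighths (3 * k) ℚ.+ + a / 1 ℚ.- 1ℚ)) (eighths (7 * k))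

φn≤7k/8 : ∀ k a → φn k a ≤ℚ eighths (7 * k)
φn≤7k/8 k a = ℚ.p⊓q≤q (+ a / 1) (eighths (7 * k))

φt≤3ka/8 : ∀ k a → φt k a ≤ℚ eighths (3 * k * a)
φt≤3ka/8 k a = ℚ.≤-trans
  (ℚ.p⊓q≤p (eighths (3 * k * a) ℚ.⊓ (eighths (3 * k) ℚ.+ + a / 1 ℚ.- 1ℚ)) (eighths (7 * k)))
  (ℚ.p⊓q≤p (eighths (3 * k * a)) (eighths (3 * k) ℚ.+ + a / 1 ℚ.- 1ℚ))

φn≤a : ∀ k a → φn k a ≤ℚ + a / 1
φn≤a k a = ℚ.p⊓q≤p (+ a / 1) (eighths (7 * k))

g≤7k/8 : (S : Subset k) → g k S ≤ℚ eighths (7 * k)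
g≤7k/8 {k} S with hasDiag S
... | true  = φt≤7k/8 k (card S)
... | false = φn≤7k/8 k (card S)

g-empty : {S : Subset k} → (∀ v → S v ≡ false) → g k S ≤ℚ 0ℚ
g-empty {k} {S} p = begin
  g k S              ≡⟨ g-offDiagonal S (anyFin-false (λ ℓ → p (ℓ , ℓ))) ⟩
  φn k (card S)      ≡⟨ cong (φn k) (card-empty p) ⟩
  φn k 0             ≤⟨ φn≤a k 0 ⟩
  0ℚ                 ∎
  where open ℚ.≤-Reasoning

byRow : V k → Fin k
byRow = proj₁

not-both : {i j : Fin k} → i ≢ j → ∀ a → ⌊ a ≟ i ⌋ ∧ ⌊ a ≟ j ⌋ ≡ false
not-both {i = i} {j} i≢j a with a ≟ i
... | yes refl = ⌊≟⌋-≢ i≢j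
... | no _     = refl

card-column∩byRow : (i j : Fin k) → card (Col j ∩ Part byRow i) ≡ 1
card-column∩byRow i j = card-cell i j (λ a b → ∧-comm ⌊ b ≟ j ⌋ ⌊ a ≟ i ⌋)

lineWeight : ∀ k → Fin k → Fin k → ℕ
lineWeight k i j = if ⌊ j ≟ i ⌋ then 10 * k else 8

line-bound : (i j : Fin k) →
  g k (Row j ∩ Part byRow i) ℚ.+ g k (Col j ∩ Part byRow i) ≤ℚ eighths (lineWeight k i j)
line-bound {k} i j with j ≟ i
... | yes refl = begin
  g k (Row i ∩ Part byRow i) ℚ.+ g k (Col i ∩ Part byRow i)
    ≤⟨ ℚ.+-mono-≤ (g≤7k/8 (Row i ∩ Part byRow i)) diagonal-cell ⟩
  eighths (7 * k) ℚ.+ eighths (3 * k)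
    ≡⟨ eighths-+ (7 * k) (3 * k) ⟩
  eighths (7 * k + 3 * k)
    ≡⟨ cong eighths (ℕ.*-distribʳ-+ k 7 3) ⟨
  eighths (10 * k)
    ∎
  where
  open ℚ.≤-Reasoning
  diagonal-cell : g k (Col i ∩ Part byRow i) ≤ℚ eighths (3 * k)
  diagonal-cell = begin
    g k (Col i ∩ Part byRow i)
      ≡⟨ g-diagonal (Col i ∩ Part byRow i) (anyFin-true i (cong₂ _∧_ (⌊≟⌋-refl i) (⌊≟⌋-refl i))) ⟩
    φt k (card (Col i ∩ Part byRow i))  ≡⟨ cong (φt k) (card-column∩byRow i i) ⟩
    φt k 1                              ≤⟨ φt≤3ka/8 k 1 ⟩
    eighths (3 * k * 1)                 ≡⟨ cong eighths (ℕ.*-identityʳ (3 * k)) ⟩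
    eighths (3 * k)                     ∎
... | no j≢i = begin
  g k (Row j ∩ Part byRow i) ℚ.+ g k (Col j ∩ Part byRow i)
    ≤⟨ ℚ.+-mono-≤ (g-empty (λ (a , _) → not-both j≢i a)) off-diagonal-cell ⟩
  0ℚ ℚ.+ 1ℚ
    ≡⟨ ℚ.+-identityˡ 1ℚ ⟩
  1ℚ
    ≡⟨⟩
  eighths 8
    ∎
  where
  open ℚ.≤-Reasoning
  off-diagonal-cell : g k (Col j ∩ Part byRow i) ≤ℚ 1ℚ
  off-diagonal-cell = begin
    g k (Col j ∩ Part byRow i)
      ≡⟨ g-offDiagonal (Col j ∩ Part byRow i) (anyFin-false (not-both j≢i)) ⟩
    φn k (card (Col j ∩ Part byRow i))  ≡⟨ cong (φn k) (card-column∩byRow i j) ⟩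
    φn k 1                              ≤⟨ φn≤a k 1 ⟩
    1ℚ                                  ∎

block-bound : (i : Fin k) → f k (Part byRow i) ≤ℚ eighths (sumℕ (lineWeight k i))
block-bound {k} i =
  ℚ.≤-trans (sumℚ-mono-≤ (line-bound i)) (ℚ.≤-reflexive (sumℚ-eighths (lineWeight k i)))

sumℕ-lineWeight : ∀ m (i : Fin (suc m)) → sumℕ (lineWeight (suc m) i) ≡ 18 * m + 10
sumℕ-lineWeight m i = ℕ.+-cancelʳ-≡ 8 _ _ (begin
  sumℕ (lineWeight (suc m) i) + 8  ≡⟨ sumℕ-except i diagonal off-diagonal ⟩
  10 * suc m + suc m * 8           ≡⟨ identity m ⟩
  18 * m + 10 + 8                  ∎)
  where
  open ≡-Reasoning
  diagonal : lineWeight (suc m) i i ≡ 10 * suc m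
  diagonal = cong (λ b → if b then 10 * suc m else 8) (⌊≟⌋-refl i)
  off-diagonal : ∀ j → j ≢ i → lineWeight (suc m) i j ≡ 8
  off-diagonal j j≢i = cong (λ b → if b then 10 * suc m else 8) (⌊≟⌋-≢ j≢i)
  identity : ∀ m → 10 * suc m + suc m * 8 ≡ 18 * m + 10 + 8
  identity = ℕ-Solver.solve-∀

eighths-total : ∀ m →
  eighths (suc m * (18 * m + 10)) ≡ (+ (9 * suc m * suc m) - + (4 * suc m)) / 4
eighths-total m = begin
  eighths (suc m * (18 * m + 10))                          ≡⟨ cong eighths (halve m) ⟩
  eighths (2 * h)                                          ≡⟨ eighths-double h ⟩
  + h / 4                                                  ≡⟨ cong (_/ 4) (+[m+n]-+n≡+m h (4 * suc m)) ⟨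
  (+ (h + 4 * suc m) - + (4 * suc m)) / 4                  ≡⟨ cong (λ a → (+ a - + (4 * suc m)) / 4) (square m) ⟩
  (+ (9 * suc m * suc m) - + (4 * suc m)) / 4              ∎
  where
  open ≡-Reasoning
  h = suc m * (9 * m + 5)
  halve : ∀ m → suc m * (18 * m + 10) ≡ 2 * (suc m * (9 * m + 5))
  halve = ℕ-Solver.solve-∀
  square : ∀ m → suc m * (9 * m + 5) + 4 * suc m ≡ 9 * suc m * suc m
  square = ℕ-Solver.solve-∀

byRow-cost : ∀ k → cost k byRow ≤ℚ (+ (9 * k * k) - + (4 * k)) / 4
byRow-cost zero    = ℚ.≤-refl
byRow-cost k@(suc m) = begin
  cost k byRow                                     ≤⟨ sumℚ-mono-≤ (block-bound {k}) ⟩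
  sumℚ (λ i → eighths (sumℕ (lineWeight k i)))     ≡⟨ sumℚ-eighths (λ i → sumℕ (lineWeight k i)) ⟩
  eighths (sumℕ (λ i → sumℕ (lineWeight k i)))     ≡⟨ cong eighths (sumℕ-const (18 * m + 10) (sumℕ-lineWeight m)) ⟩
  eighths (k * (18 * m + 10))                      ≡⟨ eighths-total m ⟩
  (+ (9 * k * k) - + (4 * k)) / 4                  ∎
  where open ℚ.≤-Reasoning

-- The row partition works for every k: the hypothesis k ≥ 4 is unused.
lemma2p8 : (k : ℕ) → 4 ≤ k →
    Σ (V k → Fin k) λ σ →
      ((i : Fin k) → σ (i , i) ≡ i) ×
      (cost k σ ≤ℚ ((+ (9 * k * k) - + (4 * k)) / 4))
lemma2p8 k _ = byRow , (λ _ → refl) , byRow-cost k
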